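{- Let $A$ be a finite alphabet totally ordered by $<$, and let $L\subseteq A^{*}$ be an infinite rational language recognised by a deterministic finite automaton with $k$ states. Let $p\geq 1$ and $0\le r<p$ be integers and $X_{p,r}=p\mathbb{N}+r$ the set of nonnegative integers congruent to $r$ modulo $p$. Then the language $\mathrm{rep}_L(X_{p,r})=\{\mathrm{rep}_L(n)\mid n\in X_{p,r}\}\subseteq A^{*}$ is recognised by a deterministic finite automaton with at most $k\,p^{k}$ states.
   Context: The strict radix order $\prec$ on $A^{*}$: $u\prec v$ if either $|u|<|v|$, or $|u|=|v|$, $u=wau'$, $v=wbv'$ with letters $a<b$. For an infinite language $L\subseteq A^{*}$ (the abstract numeration system $(L,A,<)$), $\mathrm{rep}_L(n)$ denotes the $(n+1)$-th word of $L$ in the radix order, for $n\in\mathbb{N}$ (so $\mathrm{rep}_L(0)$ is the smallest word of $L$). -}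

module Defs where

open import Data.Nat using (ℕ; zero; suc; _<ᵇ_; _≡ᵇ_)
open import Data.Fin using (Fin; toℕ)
open import Data.List using (List; []; _∷_; length; foldl)
open import Data.Bool using (Bool; true; false; if_then_else_; _∧_; _∨_; T)
open import Data.Product using (Σ; _×_; ∃)
open import Data.List.Membership.Propositional using (_∈_)
open import Relation.Nullary using (¬_)
open import Function.Bundles using (_↔_)

Word : ℕ → Set
Word m = List (Fin m)

Language : ℕ → Set₁
Language m = Word m → Set

lexLt : ∀ {m} → Word m → Word m → Bool
lexLt [] _ = false
lexLt (_ ∷ _) [] = false
lexLt (a ∷ u) (b ∷ v) =
  if toℕ a <ᵇ toℕ b then true
  else (if toℕ a ≡ᵇ toℕ b then lexLt u v else false)

radixLt : ∀ {m} → Word m → Word m → Bool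
radixLt u v = (length u <ᵇ length v) ∨ ((length u ≡ᵇ length v) ∧ lexLt u v)

_≺_ : ∀ {m} → Word m → Word m → Set
u ≺ v = T (radixLt u v)

record DFA (k m : ℕ) : Set where
  field
    start : Fin k
    δ     : Fin k → Fin m → Fin k
    final : Fin k → Bool

  run : Fin k → Word m → Fin k
  run q w = foldl δ q w

  accepts : Word m → Bool
  accepts w = final (run start w)

Lang : ∀ {k m} → DFA k m → Language m
Lang D w = T (DFA.accepts D w)

Infinite : ∀ {m} → Language m → Set
Infinite {m} L = ¬ (Σ (List (Word m)) λ ws → ∀ w → L w → w ∈ ws)

-- w = rep_L(n): w ∈ L and exactly n words of L are radix-smaller than w.
IsRep : ∀ {m} → Language m → ℕ → Word m → Set
IsRep {m} L n w = L w × (Fin n ↔ Σ (Word m) λ v → L v × v ≺ w)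

-- The words radix-smaller than wa are ε, the words ub with u ≺ w and b arbitrary,
-- and the words wc with c < a.  So if N_s(w) counts the words smaller than w on
-- which the automaton of L ends in state s, then
--   N_s(wa) = [s = q₀] + Σ_t N_t(w) · #{b | δ(t,b) = s} + #{c < a | δ(δ(q₀,w),c) = s},
-- an affine recurrence that sees w only through δ(q₀,w).  Modulo p, the pair
-- (δ(q₀,w), (N_s(w) mod p)_s) takes at most k·p^k values and is updated letter by
-- letter, so it is the state of a DFA.  For w ∈ L the index rep_L⁻¹(w) is
-- Σ_{s final} N_s(w), so accepting when δ(q₀,w) is final and this sum is ≡ r (mod p)
-- recognises rep_L(pℕ + r).
module Submission where

open import Defs
open import Data.Bool using (Bool; true; false; _∧_; _∨_; T)
open import Data.Bool.Properties using (T-∧; T-∨; T-≡; T-irrelevant; ∨-identityʳ)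
open import Data.Empty using (⊥-elim)
open import Data.Fin
  using (Fin; zero; suc; toℕ; _≟_; combine; remQuot; funToFin; finToFun)
open import Data.Fin.Properties
  using (toℕ-injective; toℕ-fromℕ<; remQuot-combine; finToFun-funToFin; cantor-schröder-bernstein)
open import Data.List
  using (List; []; _∷_; _++_; _∷ʳ_; length; reverse; map; foldl; filter; filterᵇ; lookup;
         allFin; cartesianProductWith)
open import Data.List.Properties
  using (unfold-reverse; reverse-injective; reverse-involutive; ∷-injective; ∷-injectiveˡ;
         foldl-∷ʳ; map-++; map-∘; map-cong)
open import Data.List.Membership.Propositional using (_∈_)
open import Data.List.Membership.Propositional.Properties
  using (∈-++⁻; ∈-++⁺ˡ; ∈-++⁺ʳ; ∈-map⁻; ∈-map⁺; ∈-filter⁻; ∈-filter⁺; ∈-allFin; ∈-lookup;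
         ∈-cartesianProductWith⁻; ∈-cartesianProductWith⁺)
open import Data.List.Relation.Unary.All using (tabulate)
import Data.List.Relation.Unary.All as All
open import Data.List.Relation.Unary.AllPairs using (_∷_)
open import Data.List.Relation.Unary.Any using (here; there; index)
open import Data.List.Relation.Unary.Any.Properties using (lookup-index)
open import Data.List.Relation.Unary.Unique.Propositional using (Unique; [])
import Data.List.Relation.Unary.Unique.Propositional.Properties as Unique
open import Data.Nat as ℕ
  using (ℕ; zero; suc; _+_; _*_; _^_; _%_; _/_; _≤_; _<_; _<ᵇ_; _≡ᵇ_; _<?_; NonZero; >-nonZero)
open import Data.Nat.DivMod
  using (_mod_; %-distribˡ-+; %-distribˡ-*; m%n%n≡m%n; m≡m%n+[m/n]*n; [m+kn]%n≡m%n; m<n⇒m%n≡m)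
open import Data.Nat.ListAction using (sum)
open import Data.Nat.ListAction.Properties using (sum-++)
open import Data.Nat.Properties
  using (<ᵇ⇒<; <⇒<ᵇ; ≡ᵇ⇒≡; ≡⇒≡ᵇ; <-irrefl; suc-injective; ≤-refl;
         +-comm; *-comm; +-identityʳ; *-distribʳ-+; +-*-semiring)
open import Data.Product as Product using (Σ; _×_; ∃; _,_; proj₁; proj₂)
open import Data.Sum as Sum using (_⊎_; inj₁; inj₂)
open import Function using (_∘_; flip)
open import Function.Bundles using (_⇔_; mk⇔; _↔_; mk↔ₛ′; Injection; Equivalence)
open import Function.Construct.Composition using (_↔-∘_)
open import Function.Construct.Symmetry using (↔-sym)
open import Function.Properties.Inverse using (↔⇒↣)
open import Relation.Binary.PropositionalEquality
open import Relation.Nullary using (¬_; yes; no; does)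
open import Relation.Nullary.Decidable using (T?)
open import Relation.Nullary.Irrelevant using (Irrelevant)

open import Algebra.Properties.Semiring.Sum +-*-semiring
  using (sum-syntax; sum-cong-≗; ∑-distrib-+; sum-replicate-zero)
open Equivalence using (to; from)

¬T⇒≡false : ∀ {b} → ¬ T b → b ≡ false
¬T⇒≡false {false} _  = refl
¬T⇒≡false {true}  ¬t = ⊥-elim (¬t _)

<ᵇ-irrefl : ∀ n → (n <ᵇ n) ≡ false
<ᵇ-irrefl n = ¬T⇒≡false (<-irrefl refl ∘ <ᵇ⇒< n n)

≡ᵇ-refl : ∀ n → (n ≡ᵇ n) ≡ true
≡ᵇ-refl n = T-≡ .to (≡⇒≡ᵇ n n refl)

≢⇒≡ᵇ≡false : ∀ {m n} → m ≢ n → (m ≡ᵇ n) ≡ false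
≢⇒≡ᵇ≡false {m} {n} m≢n = ¬T⇒≡false (m≢n ∘ ≡ᵇ⇒≡ m n)

module _ {m : ℕ} where

  -- Compares letters through toℕ, exactly as lexLt does, so that lexLt-∷ʳ holds by computation.
  infix 4 _==_
  _==_ : Word m → Word m → Bool
  []      == []      = true
  (a ∷ u) == (b ∷ w) = (toℕ a ≡ᵇ toℕ b) ∧ (u == w)
  _       == _       = false

  ==⇒≡ : ∀ (u w : Word m) → T (u == w) → u ≡ w
  ==⇒≡ []      []      _ = refl
  ==⇒≡ (a ∷ u) (b ∷ w) t with T-∧ .to t
  ... | a≡b , u==w = cong₂ _∷_ (toℕ-injective (≡ᵇ⇒≡ _ _ a≡b)) (==⇒≡ u w u==w)

  ==-refl : ∀ (u : Word m) → T (u == u)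
  ==-refl []      = _
  ==-refl (a ∷ u) = T-∧ .from (≡⇒≡ᵇ (toℕ a) (toℕ a) refl , ==-refl u)

  length≢⇒==≡false : ∀ {u w : Word m} → length u ≢ length w → (u == w) ≡ false
  length≢⇒==≡false {u} {w} |u|≢|w| = ¬T⇒≡false (|u|≢|w| ∘ cong length ∘ ==⇒≡ u w)

  length-∷ʳ : ∀ (u : Word m) a → length (u ∷ʳ a) ≡ suc (length u)
  length-∷ʳ []      a = refl
  length-∷ʳ (_ ∷ u) a = cong suc (length-∷ʳ u a)

  lexLt-∷ʳ : ∀ (u w : Word m) b a → length u ≡ length w →
    lexLt (u ∷ʳ b) (w ∷ʳ a) ≡ lexLt u w ∨ ((u == w) ∧ (toℕ b <ᵇ toℕ a))
  lexLt-∷ʳ [] [] b a _ with toℕ b <ᵇ toℕ a | toℕ b ≡ᵇ toℕ a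
  ... | true  | _     = refl
  ... | false | true  = refl
  ... | false | false = refl
  lexLt-∷ʳ (c ∷ u) (d ∷ w) b a |u|≡|w| with toℕ c <ᵇ toℕ d | toℕ c ≡ᵇ toℕ d
  ... | true  | _     = refl
  ... | false | true  = lexLt-∷ʳ u w b a (suc-injective |u|≡|w|)
  ... | false | false = refl

  radixLt-∷ʳ : ∀ (u w : Word m) b a →
    radixLt (u ∷ʳ b) (w ∷ʳ a) ≡ radixLt u w ∨ ((u == w) ∧ (toℕ b <ᵇ toℕ a))
  radixLt-∷ʳ u w b a rewrite length-∷ʳ u b | length-∷ʳ w a with length u ℕ.≟ length w
  ... | yes |u|≡|w| rewrite lexLt-∷ʳ u w b a |u|≡|w| | |u|≡|w|
                          | <ᵇ-irrefl (length w) | ≡ᵇ-refl (length w) = refl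
  ... | no  |u|≢|w| rewrite ≢⇒≡ᵇ≡false |u|≢|w| | length≢⇒==≡false {u} {w} |u|≢|w|
                          = sym (∨-identityʳ _)

  ≺-∷ʳ : ∀ {u w : Word m} {b a} → (u ∷ʳ b) ≺ (w ∷ʳ a) ⇔ (u ≺ w ⊎ (u ≡ w × toℕ b < toℕ a))
  ≺-∷ʳ {u} {w} {b} {a} = mk⇔ ⇒ ⇐
    where
    ⇒ : (u ∷ʳ b) ≺ (w ∷ʳ a) → u ≺ w ⊎ (u ≡ w × toℕ b < toℕ a)
    ⇒ ub≺wa with T-∨ .to (subst T (radixLt-∷ʳ u w b a) ub≺wa)
    ... | inj₁ u≺w = inj₁ u≺w
    ... | inj₂ u==w∧b<a with T-∧ .to u==w∧b<a
    ...   | u==w , b<a = inj₂ (==⇒≡ u w u==w , <ᵇ⇒< _ _ b<a)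
    ⇐ : u ≺ w ⊎ (u ≡ w × toℕ b < toℕ a) → (u ∷ʳ b) ≺ (w ∷ʳ a)
    ⇐ = subst T (sym (radixLt-∷ʳ u w b a)) ∘ T-∨ .from ∘ Sum.map₂ λ where
      (refl , b<a) → T-∧ .from (==-refl u , <⇒<ᵇ b<a)

  ≺-irrefl : ∀ (u : Word m) → ¬ u ≺ u
  ≺-irrefl u rewrite <ᵇ-irrefl (length u) | ≡ᵇ-refl (length u) = lexLt-irrefl u
    where
    lexLt-irrefl : ∀ (u : Word m) → ¬ T (lexLt u u)
    lexLt-irrefl []      ()
    lexLt-irrefl (a ∷ u) rewrite <ᵇ-irrefl (toℕ a) | ≡ᵇ-refl (toℕ a) = lexLt-irrefl u

  ¬≺[] : ∀ (u : Word m) → ¬ u ≺ []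
  ¬≺[] []      ()
  ¬≺[] (_ ∷ _) ()

  []≺∷ʳ : ∀ (w : Word m) a → [] ≺ (w ∷ʳ a)
  []≺∷ʳ w a rewrite length-∷ʳ w a = _

  -- From here on a word x often stands for the word reverse x, so that appending a
  -- letter, the step of the radix order and of automata, becomes _∷_.
  infix 4 _≺ᴿ_
  _≺ᴿ_ : Word m → Word m → Set
  u ≺ᴿ x = reverse u ≺ reverse x

  ∷-≺ᴿ-∷ : ∀ {u x : Word m} {b a} → b ∷ u ≺ᴿ a ∷ x ⇔ (u ≺ᴿ x ⊎ (u ≡ x × toℕ b < toℕ a))
  ∷-≺ᴿ-∷ {u} {x} {b} {a} rewrite unfold-reverse b u | unfold-reverse a x =
    mk⇔ (Sum.map₂ (Product.map₁ reverse-injective) ∘ ≺-∷ʳ .to)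
        (≺-∷ʳ .from ∘ Sum.map₂ (Product.map₁ (cong reverse)))

  lettersBelow : Fin m → List (Fin m)
  lettersBelow a = filter (λ b → toℕ b <? toℕ a) (allFin m)

  extensionsᴿ : List (Word m) → List (Word m)
  extensionsᴿ us = cartesianProductWith (flip _∷_) us (allFin m)

  predecessorsᴿ : Word m → List (Word m)
  predecessorsᴿ []      = []
  predecessorsᴿ (a ∷ x) = [] ∷ (extensionsᴿ (predecessorsᴿ x) ++ map (_∷ x) (lettersBelow a))

  ∈-predecessorsᴿ⁻ : ∀ {u} x → u ∈ predecessorsᴿ x → u ≺ᴿ x
  ∈-predecessorsᴿ⁻         []      ()
  ∈-predecessorsᴿ⁻ {[]}    (a ∷ x) _ rewrite unfold-reverse a x = []≺∷ʳ (reverse x) a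
  ∈-predecessorsᴿ⁻ {b ∷ u} (a ∷ x) (there bu∈) = ∷-≺ᴿ-∷ .from (Sum.map extended sibling (∈-++⁻ _ bu∈))
    where
    extended : b ∷ u ∈ extensionsᴿ (predecessorsᴿ x) → u ≺ᴿ x
    extended bu∈ with ∈-cartesianProductWith⁻ (flip _∷_) (predecessorsᴿ x) (allFin m) bu∈
    ... | _ , _ , u∈ , _ , refl = ∈-predecessorsᴿ⁻ x u∈
    sibling : b ∷ u ∈ map (_∷ x) (lettersBelow a) → u ≡ x × toℕ b < toℕ a
    sibling bu∈ with ∈-map⁻ (_∷ x) bu∈
    ... | _ , b∈ , refl = refl , proj₂ (∈-filter⁻ (λ b → toℕ b <? toℕ a) {xs = allFin m} b∈)

  ∈-predecessorsᴿ⁺ : ∀ {u} x → u ≺ᴿ x → u ∈ predecessorsᴿ x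
  ∈-predecessorsᴿ⁺ {u}     []      u≺[] = ⊥-elim (¬≺[] (reverse u) u≺[])
  ∈-predecessorsᴿ⁺ {[]}    (a ∷ x) _    = here refl
  ∈-predecessorsᴿ⁺ {b ∷ u} (a ∷ x) bu≺ax with ∷-≺ᴿ-∷ {u} {x} .to bu≺ax
  ... | inj₁ u≺x =
    there (∈-++⁺ˡ (∈-cartesianProductWith⁺ (flip _∷_) (∈-predecessorsᴿ⁺ x u≺x) (∈-allFin b)))
  ... | inj₂ (refl , b<a) =
    there (∈-++⁺ʳ _ (∈-map⁺ (_∷ x) (∈-filter⁺ (λ b → toℕ b <? toℕ a) (∈-allFin b) b<a)))

  predecessorsᴿ-unique : ∀ x → Unique (predecessorsᴿ x)
  predecessorsᴿ-unique []      = []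
  predecessorsᴿ-unique (a ∷ x) = tabulate []∉ ∷ Unique.++⁺ extended-unique siblings-unique disjoint
    where
    extended siblings : List (Word m)
    extended = extensionsᴿ (predecessorsᴿ x)
    siblings = map (_∷ x) (lettersBelow a)
    []∉ : ∀ {v} → v ∈ extended ++ siblings → [] ≢ v
    []∉ v∈ refl with ∈-++⁻ extended v∈
    ... | inj₁ ∈extended with ∈-cartesianProductWith⁻ (flip _∷_) (predecessorsᴿ x) (allFin m) ∈extended
    ...   | _ , _ , _ , _ , ()
    []∉ v∈ refl | inj₂ ∈siblings with ∈-map⁻ (_∷ x) ∈siblings
    ...   | _ , _ , ()
    extended-unique : Unique extended
    extended-unique = Unique.cartesianProductWith⁺ (flip _∷_)
      (λ eq → proj₂ (∷-injective eq) , proj₁ (∷-injective eq))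
      (predecessorsᴿ-unique x) (Unique.allFin⁺ m)
    siblings-unique : Unique siblings
    siblings-unique =
      Unique.map⁺ ∷-injectiveˡ (Unique.filter⁺ (λ b → toℕ b <? toℕ a) (Unique.allFin⁺ m))
    disjoint : ∀ {v} → ¬ (v ∈ extended × v ∈ siblings)
    disjoint (∈extended , ∈siblings)
      with ∈-cartesianProductWith⁻ (flip _∷_) (predecessorsᴿ x) (allFin m) ∈extended
         | ∈-map⁻ (_∷ x) ∈siblings
    ... | _ , _ , u∈ , _ , refl | _ , _ , eq with ∷-injective eq
    ...   | _ , refl = ≺-irrefl (reverse x) (∈-predecessorsᴿ⁻ x u∈)

module _ {A : Set} where

  index-lookup : ∀ {xs : List A} → Unique xs → ∀ i (x∈ : lookup xs i ∈ xs) → index x∈ ≡ i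
  index-lookup _            zero    (here _)   = refl
  index-lookup (x∉ ∷ _)     zero    (there x∈) = ⊥-elim (All.lookup x∉ x∈ refl)
  index-lookup (x∉ ∷ _)     (suc i) (here eq)  = ⊥-elim (All.lookup x∉ (∈-lookup i) (sym eq))
  index-lookup (_ ∷ unique) (suc i) (there x∈) = cong suc (index-lookup unique i x∈)

  Unique⇒Fin-length↔ : ∀ {P : A → Set} {xs} → Unique xs → (∀ {x} → Irrelevant (P x)) →
    (∀ {x} → x ∈ xs ⇔ P x) → Fin (length xs) ↔ Σ A P
  Unique⇒Fin-length↔ {P} {xs} unique irrelevant ∈⇔P = mk↔ₛ′ element position
    (λ (x , px) → element-position (lookup-index (∈⇔P .from px)) px)
    (λ i → index-lookup unique i (∈⇔P .from (∈⇔P .to (∈-lookup i))))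
    where
    element : Fin (length xs) → Σ A P
    element i = lookup xs i , ∈⇔P .to (∈-lookup i)
    position : Σ A P → Fin (length xs)
    position (x , px) = index (∈⇔P .from px)
    element-position : ∀ {x y} → x ≡ y → (px : P x) {py : P y} → (y , py) ≡ (x , px)
    element-position refl px = cong (_ ,_) (irrelevant _ px)

Fin-↔-unique : ∀ {A : Set} {m n} → Fin m ↔ A → Fin n ↔ A → m ≡ n
Fin-↔-unique {m = m} {n} f g =
  cantor-schröder-bernstein (Injection.injective (↔⇒↣ h)) (Injection.injective (↔⇒↣ (↔-sym h)))
  where
  h : Fin m ↔ Fin n
  h = ↔-sym g ↔-∘ f

𝟙 : Bool → ℕ
𝟙 true  = 1
𝟙 false = 0

length-filterᵇ : ∀ {A : Set} (f : A → Bool) xs → length (filterᵇ f xs) ≡ sum (map (𝟙 ∘ f) xs)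
length-filterᵇ f []       = refl
length-filterᵇ f (x ∷ xs) with f x
... | true  = cong suc (length-filterᵇ f xs)
... | false = length-filterᵇ f xs

IsRep-reverse⇔ : ∀ {m n} (f : Word m → Bool) x → IsRep (T ∘ f) n (reverse x) ⇔
  (T (f (reverse x)) × n ≡ sum (map (𝟙 ∘ f ∘ reverse) (predecessorsᴿ x)))
IsRep-reverse⇔ {m} f x = mk⇔
  (λ (fw , n↔) → fw , trans (Fin-↔-unique n↔ enumeration) count)
  (λ (fw , n≡) → fw , subst (λ n → Fin n ↔ _) (trans count (sym n≡)) enumeration)
  where
  below : List (Word m)
  below = filterᵇ f (map reverse (predecessorsᴿ x))
  ∈below⇔ : ∀ {v} → v ∈ below ⇔ (T (f v) × v ≺ reverse x)
  ∈below⇔ {v} = mk⇔ ⇒ ⇐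
    where
    ⇒ : v ∈ below → T (f v) × v ≺ reverse x
    ⇒ v∈ with ∈-filter⁻ (T? ∘ f) {xs = map reverse (predecessorsᴿ x)} v∈
    ... | v∈′ , fv with ∈-map⁻ reverse v∈′
    ...   | u , u∈ , refl = fv , ∈-predecessorsᴿ⁻ x u∈
    ⇐ : T (f v) × v ≺ reverse x → v ∈ below
    ⇐ (fv , v≺) = ∈-filter⁺ (T? ∘ f) (subst (_∈ _) (reverse-involutive v) (∈-map⁺ reverse rv∈)) fv
      where
      rv∈ : reverse v ∈ predecessorsᴿ x
      rv∈ = ∈-predecessorsᴿ⁺ x (subst (_≺ reverse x) (sym (reverse-involutive v)) v≺)
  enumeration : Fin (length below) ↔ Σ (Word m) λ v → T (f v) × v ≺ reverse x
  enumeration = Unique⇒Fin-length↔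
    (Unique.filter⁺ (T? ∘ f) (Unique.map⁺ reverse-injective (predecessorsᴿ-unique x)))
    (λ (a , b) (c , d) → cong₂ _,_ (T-irrelevant a c) (T-irrelevant b d)) ∈below⇔
  count : length below ≡ sum (map (𝟙 ∘ f ∘ reverse) (predecessorsᴿ x))
  count = trans (length-filterᵇ f (map reverse (predecessorsᴿ x)))
                (cong sum (sym (map-∘ {g = 𝟙 ∘ f} (predecessorsᴿ x))))

𝟙[_≡_] : ∀ {n} → Fin n → Fin n → ℕ
𝟙[ q ≡ s ] = 𝟙 (does (q ≟ s))

∑-𝟙[≡] : ∀ {n} (q : Fin n) (g : Fin n → ℕ) → ∑[ s < n ] (𝟙[ q ≡ s ] * g s) ≡ g q
∑-𝟙[≡] {suc n} zero    g =
  trans (cong₂ _+_ (+-identityʳ (g zero)) (sum-replicate-zero n)) (+-identityʳ (g zero))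
∑-𝟙[≡] {suc n} (suc q) g = ∑-𝟙[≡] q (λ s → g (suc s))

∑-fibres : ∀ {A : Set} {n} (c : A → Fin n) (g : Fin n → ℕ) xs →
  sum (map (g ∘ c) xs) ≡ ∑[ s < n ] (sum (map (λ u → 𝟙[ c u ≡ s ]) xs) * g s)
∑-fibres {n = n} c g []       = sym (sum-replicate-zero n)
∑-fibres {n = n} c g (x ∷ xs) = begin
  g (c x) + sum (map (g ∘ c) xs)
    ≡⟨ cong₂ _+_ (sym (∑-𝟙[≡] (c x) g)) (∑-fibres c g xs) ⟩
  ∑[ s < n ] (𝟙[ c x ≡ s ] * g s) + ∑[ s < n ] (fibre s * g s)
    ≡⟨ ∑-distrib-+ (λ s → 𝟙[ c x ≡ s ] * g s) (λ s → fibre s * g s) ⟨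
  ∑[ s < n ] (𝟙[ c x ≡ s ] * g s + fibre s * g s)
    ≡⟨ sum-cong-≗ (λ s → *-distribʳ-+ (g s) (𝟙[ c x ≡ s ]) (fibre s)) ⟨
  ∑[ s < n ] ((𝟙[ c x ≡ s ] + fibre s) * g s) ∎
  where
  open ≡-Reasoning
  fibre : Fin n → ℕ
  fibre s = sum (map (λ u → 𝟙[ c u ≡ s ]) xs)

∑-++ : ∀ {A : Set} (f : A → ℕ) xs ys → sum (map f (xs ++ ys)) ≡ sum (map f xs) + sum (map f ys)
∑-++ f xs ys = trans (cong sum (map-++ f xs ys)) (sum-++ (map f xs) (map f ys))

∑-map : ∀ {A B : Set} (f : B → ℕ) (g : A → B) xs → sum (map f (map g xs)) ≡ sum (map (f ∘ g) xs)
∑-map f g xs = cong sum (sym (map-∘ xs))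

∑-cartesianProductWith : ∀ {A B C : Set} (f : C → ℕ) (g : A → B → C) xs ys →
  sum (map f (cartesianProductWith g xs ys)) ≡ sum (map (λ x → sum (map (f ∘ g x) ys)) xs)
∑-cartesianProductWith f g []       ys = refl
∑-cartesianProductWith f g (x ∷ xs) ys = begin
  sum (map f (map (g x) ys ++ cartesianProductWith g xs ys))
    ≡⟨ ∑-++ f (map (g x) ys) _ ⟩
  sum (map f (map (g x) ys)) + sum (map f (cartesianProductWith g xs ys))
    ≡⟨ cong₂ _+_ (∑-map f (g x) ys) (∑-cartesianProductWith f g xs ys) ⟩
  sum (map (f ∘ g x) ys) + sum (map (λ x → sum (map (f ∘ g x) ys)) xs) ∎
  where open ≡-Reasoning

module Congruence (p : ℕ) .{{_ : NonZero p}} where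

  infix 4 _≈_
  _≈_ : ℕ → ℕ → Set
  a ≈ b = a % p ≡ b % p

  toℕ-mod-≈ : ∀ n → toℕ (n mod p) ≈ n
  toℕ-mod-≈ n = trans (cong (_% p) (toℕ-fromℕ< _)) (m%n%n≡m%n n p)

  ≈-+ : ∀ {a b c d} → a ≈ b → c ≈ d → a + c ≈ b + d
  ≈-+ {a} {b} {c} {d} a≈b c≈d = begin
    (a + c) % p           ≡⟨ %-distribˡ-+ a c p ⟩
    (a % p + c % p) % p   ≡⟨ cong₂ (λ x y → (x + y) % p) a≈b c≈d ⟩
    (b % p + d % p) % p   ≡⟨ %-distribˡ-+ b d p ⟨
    (b + d) % p           ∎
    where open ≡-Reasoning

  ≈-*ʳ : ∀ {a b} c → a ≈ b → a * c ≈ b * c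
  ≈-*ʳ {a} {b} c a≈b = begin
    (a * c) % p             ≡⟨ %-distribˡ-* a c p ⟩
    (a % p * (c % p)) % p   ≡⟨ cong (λ x → (x * (c % p)) % p) a≈b ⟩
    (b % p * (c % p)) % p   ≡⟨ %-distribˡ-* b c p ⟨
    (b * c) % p             ∎
    where open ≡-Reasoning

  ≈-∑ : ∀ {n} {f g : Fin n → ℕ} → (∀ i → f i ≈ g i) → ∑[ i < n ] f i ≈ ∑[ i < n ] g i
  ≈-∑ {zero}  _   = refl
  ≈-∑ {suc n} f≈g = ≈-+ (f≈g zero) (≈-∑ (λ i → f≈g (suc i)))

  %≡⇔ : ∀ {n r} → r < p → n % p ≡ r ⇔ ∃ λ q → p * q + r ≡ n
  %≡⇔ {n} {r} r<p = mk⇔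
    (λ n%p≡r → n / p , (begin
      p * (n / p) + r     ≡⟨ +-comm (p * (n / p)) r ⟩
      r + p * (n / p)     ≡⟨ cong₂ _+_ n%p≡r (*-comm (n / p) p) ⟨
      n % p + n / p * p   ≡⟨ m≡m%n+[m/n]*n n p ⟨
      n                   ∎))
    (λ (q , p*q+r≡n) → begin
      n % p               ≡⟨ cong (_% p) p*q+r≡n ⟨
      (p * q + r) % p     ≡⟨ cong (_% p) (trans (+-comm (p * q) r) (cong (r +_) (*-comm p q))) ⟩
      (r + q * p) % p     ≡⟨ [m+kn]%n≡m%n r q p ⟩
      r % p               ≡⟨ m<n⇒m%n≡m r<p ⟩
      r                   ∎)
    where open ≡-Reasoning

module _ {k m} (D : DFA k m) where
  open DFA D

  runᴿ : Word m → Fin k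
  runᴿ []      = start
  runᴿ (a ∷ x) = δ (runᴿ x) a

  accepts-reverse : ∀ x → accepts (reverse x) ≡ final (runᴿ x)
  accepts-reverse x = cong final (run-reverse x)
    where
    run-reverse : ∀ x → run start (reverse x) ≡ runᴿ x
    run-reverse []      = refl
    run-reverse (a ∷ x) = begin
      foldl δ start (reverse (a ∷ x))   ≡⟨ cong (foldl δ start) (unfold-reverse a x) ⟩
      foldl δ start (reverse x ∷ʳ a)    ≡⟨ foldl-∷ʳ δ start a (reverse x) ⟩
      δ (run start (reverse x)) a       ≡⟨ cong (λ q → δ q a) (run-reverse x) ⟩
      δ (runᴿ x) a                      ∎
      where open ≡-Reasoning

module Construction {k m} (D : DFA k m) (p : ℕ) .{{_ : NonZero p}} (r : ℕ) where
  open DFA D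
  open Congruence p

  visits : Word m → Fin k → ℕ
  visits x s = sum (map (λ u → 𝟙[ runᴿ D u ≡ s ]) (predecessorsᴿ x))

  edges : Fin k → Fin k → ℕ
  edges t s = sum (map (λ b → 𝟙[ δ t b ≡ s ]) (allFin m))

  edgesBelow : Fin k → Fin m → Fin k → ℕ
  edgesBelow t a s = sum (map (λ b → 𝟙[ δ t b ≡ s ]) (lettersBelow a))

  visitsStep : (Fin k → ℕ) → Fin k → Fin m → Fin k → ℕ
  visitsStep v q a s = 𝟙[ start ≡ s ] + (∑[ t < k ] (v t * edges t s) + edgesBelow q a s)

  visits-∷ : ∀ a x s → visits (a ∷ x) s ≡ visitsStep (visits x) (runᴿ D x) a s
  visits-∷ a x s = cong (𝟙[ start ≡ s ] +_) (begin
    sum (map reaches (extensionsᴿ (predecessorsᴿ x) ++ map (_∷ x) (lettersBelow a)))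
      ≡⟨ ∑-++ reaches (extensionsᴿ (predecessorsᴿ x)) _ ⟩
    sum (map reaches (extensionsᴿ (predecessorsᴿ x))) + sum (map reaches (map (_∷ x) (lettersBelow a)))
      ≡⟨ cong₂ _+_ (∑-cartesianProductWith reaches (flip _∷_) (predecessorsᴿ x) (allFin m))
                   (∑-map reaches (_∷ x) (lettersBelow a)) ⟩
    sum (map (λ u → edges (runᴿ D u) s) (predecessorsᴿ x)) + edgesBelow (runᴿ D x) a s
      ≡⟨ cong (_+ edgesBelow (runᴿ D x) a s) (∑-fibres (runᴿ D) (λ t → edges t s) (predecessorsᴿ x)) ⟩
    ∑[ t < k ] (visits x t * edges t s) + edgesBelow (runᴿ D x) a s ∎)
    where
    open ≡-Reasoning
    reaches : Word m → ℕ
    reaches u = 𝟙[ runᴿ D u ≡ s ]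

  visitsStep-≈ : ∀ {v w} → (∀ t → v t ≈ w t) → ∀ q a s → visitsStep v q a s ≈ visitsStep w q a s
  visitsStep-≈ v≈w q a s =
    ≈-+ {𝟙[ start ≡ s ]} refl (≈-+ (≈-∑ (λ t → ≈-*ʳ (edges t s) (v≈w t))) refl)

  acceptedCount : (Fin k → ℕ) → ℕ
  acceptedCount v = ∑[ t < k ] (v t * 𝟙 (final t))

  acceptedBelow-visits : ∀ x →
    sum (map (𝟙 ∘ accepts ∘ reverse) (predecessorsᴿ x)) ≡ acceptedCount (visits x)
  acceptedBelow-visits x =
    trans (cong sum (map-cong (cong 𝟙 ∘ accepts-reverse D) (predecessorsᴿ x)))
          (∑-fibres (runᴿ D) (𝟙 ∘ final) (predecessorsᴿ x))

  State : Set
  State = Fin k × (Fin k → Fin p)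

  initial : State
  initial = start , λ _ → 0 mod p

  next : State → Fin m → State
  next (q , c) a = δ q a , λ s → visitsStep (toℕ ∘ c) q a s mod p

  accepting : State → Bool
  accepting (q , c) = final q ∧ (acceptedCount (toℕ ∘ c) % p ≡ᵇ r)

  Tracks : Word m → State → Set
  Tracks x (q , c) = q ≡ runᴿ D x × (∀ s → toℕ (c s) ≈ visits x s)

  initial-tracks : Tracks [] initial
  initial-tracks = refl , λ _ → toℕ-mod-≈ 0

  next-tracks : ∀ x {z} a → Tracks x z → Tracks (a ∷ x) (next z a)
  next-tracks x a (refl , c≈visits) = refl , λ s →
    trans (toℕ-mod-≈ _) (trans (visitsStep-≈ c≈visits _ a s) (cong (_% p) (sym (visits-∷ a x s))))

  accepting-tracks : ∀ x {z} → Tracks x z →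
    accepting z ≡ final (runᴿ D x) ∧ (acceptedCount (visits x) % p ≡ᵇ r)
  accepting-tracks x (refl , c≈visits) =
    cong (λ n → final _ ∧ (n ≡ᵇ r)) (≈-∑ (λ t → ≈-*ʳ (𝟙 (final t)) (c≈visits t)))

  encode : State → Fin (k * p ^ k)
  encode (q , c) = combine q (funToFin c)

  decode : Fin (k * p ^ k) → State
  decode i = Product.map₂ finToFun (remQuot (p ^ k) i)

  -- decode ∘ encode is the identity only up to pointwise equality of the counters,
  -- which is all that Tracks looks at.
  decode-encode-tracks : ∀ x z → Tracks x z → Tracks x (decode (encode z))
  decode-encode-tracks x (q , c) (q≡ , c≈visits) =
    subst (Tracks x) (cong (Product.map₂ finToFun) (sym (remQuot-combine q (funToFin c))))
      (q≡ , λ s → trans (cong (λ i → toℕ i % p) (finToFun-funToFin c s)) (c≈visits s))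

  automaton : DFA (k * p ^ k) m
  automaton = record
    { start = encode initial
    ; δ     = λ i a → encode (next (decode i) a)
    ; final = accepting ∘ decode
    }

  automaton-tracks : ∀ x → Tracks x (decode (runᴿ automaton x))
  automaton-tracks []      = decode-encode-tracks [] initial initial-tracks
  automaton-tracks (a ∷ x) = decode-encode-tracks (a ∷ x) (next (decode (runᴿ automaton x)) a)
                               (next-tracks x a (automaton-tracks x))

  accepts-automaton : ∀ x → DFA.accepts automaton (reverse x) ≡
    accepts (reverse x) ∧ (sum (map (𝟙 ∘ accepts ∘ reverse) (predecessorsᴿ x)) % p ≡ᵇ r)
  accepts-automaton x = begin
    DFA.accepts automaton (reverse x)
      ≡⟨ accepts-reverse automaton x ⟩
    accepting (decode (runᴿ automaton x))
      ≡⟨ accepting-tracks x (automaton-tracks x) ⟩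
    final (runᴿ D x) ∧ (acceptedCount (visits x) % p ≡ᵇ r)
      ≡⟨ cong₂ (λ b n → b ∧ (n % p ≡ᵇ r)) (accepts-reverse D x) (acceptedBelow-visits x) ⟨
    accepts (reverse x) ∧ (sum (map (𝟙 ∘ accepts ∘ reverse) (predecessorsᴿ x)) % p ≡ᵇ r) ∎
    where open ≡-Reasoning

  automaton-correct : r < p → ∀ x →
    Lang automaton (reverse x) ⇔ ∃ λ q → IsRep (Lang D) (p * q + r) (reverse x)
  automaton-correct r<p x = mk⇔
    (λ accepted →
      let (w∈L , index%p≡r) = T-∧ .to (subst T (accepts-automaton x) accepted)
          (q , p*q+r≡index)  = %≡⇔ r<p .to (≡ᵇ⇒≡ _ r index%p≡r)
      in  q , IsRep-reverse⇔ accepts x .from (w∈L , p*q+r≡index))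
    (λ (q , isRep) →
      let (w∈L , p*q+r≡index) = IsRep-reverse⇔ accepts x .to isRep
      in  subst T (sym (accepts-automaton x))
            (T-∧ .from (w∈L , ≡⇒≡ᵇ _ r (%≡⇔ r<p .from (q , p*q+r≡index)))))

proposition1 : ∀ {m k : ℕ} (D : DFA k m) → Infinite (Lang D) →
    (p r : ℕ) → 1 ≤ p → r < p →
    Σ ℕ λ k′ → k′ ≤ k * p ^ k × Σ (DFA k′ m) λ D′ →
    ∀ w → (Lang D′ w ⇔ (∃ λ q → IsRep (Lang D) (p * q + r) w))
proposition1 {m} {k} D _ p r 1≤p r<p = k * p ^ k , ≤-refl , automaton , λ w →
  subst (λ w → Lang automaton w ⇔ ∃ λ q → IsRep (Lang D) (p * q + r) w)
        (reverse-involutive w) (automaton-correct r<p (reverse w))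
  where
  instance
    p≢0 : NonZero p
    p≢0 = >-nonZero 1≤p
  open Construction D p r
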